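{- Let $k \ge 1$ and $2 \le m \le n \le k+1$. Then $d_k(P_m \Box P_n) = m$.
   Context: $P_n$ is the path on $n$ vertices; $P_m \Box P_n$ is the Cartesian product ($m\times n$ grid): vertices $(i,j)$, $0\le i\le m-1$, $0\le j\le n-1$, with $(i,j)$ adjacent to $(i',j')$ iff ($|i-i'|=1$ and $j=j'$) or ($i=i'$ and $|j-j'|=1$). The $k$-move deduction game ($k$ a positive integer) on a finite graph $G$: a layout places a finite number of searchers on vertices of $G$ (several searchers may share a vertex). Every searcher is initially mobile. A vertex is protected once it has been occupied by some searcher (so initially occupied vertices are protected); other vertices are unprotected. The game proceeds in stages. At each stage, for every vertex $v$ that has at least one unprotected neighbour: if the number of mobile searchers on $v$ is at least the number of unprotected neighbours of $v$, then the mobile searchers on $v$ move to the unprotected neighbours of $v$ so that each unprotected neighbour receives at least one searcher; excess mobile searchers on $v$ may also move to any of these unprotected neighbours. All moves in a stage happen simultaneously, newly occupied vertices become protected, and a searcher that has moved $k$ times becomes immobile. The process repeats until all vertices are protected or no searcher can move. A layout is successful if all vertices of $G$ end up protected. The $k$-move deduction number $d_k(G)$ is the minimum number of searchers in a successful layout on $G$. -}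

module Defs where

open import Data.Nat using (ℕ; zero; suc; _≤_; _<_; _<?_; _≟_)
open import Data.Fin using (Fin; toℕ)
import Data.Fin as Fin
open import Data.Fin.Properties using (any?)
open import Data.Bool using (Bool; true; false; T; not)
open import Data.Bool.Properties using (T?)
open import Data.List using (List; length; filter; allFin; cartesianProduct)
open import Data.Product using (Σ; ∃; ∃-syntax; _×_; _,_)
open import Data.Product.Properties using (≡-dec)
open import Data.Sum using (_⊎_)
open import Relation.Nullary using (Dec; yes; no; ¬_)
open import Relation.Nullary.Decidable using (⌊_⌋; _×-dec_; _⊎-dec_)
open import Relation.Binary.PropositionalEquality using (_≡_)
open import Relation.Binary.Construct.Closure.ReflexiveTransitive using (Star)
open import Function.Bundles using (_⇔_)

Vtx : ℕ → ℕ → Set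
Vtx m n = Fin m × Fin n

Dist1 : ℕ → ℕ → Set
Dist1 a b = (suc a ≡ b) ⊎ (suc b ≡ a)

dist1? : (a b : ℕ) → Dec (Dist1 a b)
dist1? a b = (suc a ≟ b) ⊎-dec (suc b ≟ a)

Adj : ∀ {m n} → Vtx m n → Vtx m n → Set
Adj (i , j) (i' , j') =
  (Dist1 (toℕ i) (toℕ i') × j ≡ j') ⊎ (i ≡ i' × Dist1 (toℕ j) (toℕ j'))

adj? : ∀ {m n} (v w : Vtx m n) → Dec (Adj v w)
adj? (i , j) (i' , j') =
  (dist1? (toℕ i) (toℕ i') ×-dec (j Fin.≟ j')) ⊎-dec
  ((i Fin.≟ i') ×-dec dist1? (toℕ j) (toℕ j'))

vtx? : ∀ {m n} (v w : Vtx m n) → Dec (v ≡ w)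
vtx? = ≡-dec Fin._≟_ Fin._≟_

vertices : ∀ m n → List (Vtx m n)
vertices m n = cartesianProduct (allFin m) (allFin n)

record State (m n t : ℕ) : Set where
  field
    pos   : Fin t → Vtx m n
    moves : Fin t → ℕ         -- number of moves made so far by each searcher
    prot  : Vtx m n → Bool
open State public

module _ (k : ℕ) {m n t : ℕ} where

  unprotNbrs : State m n t → Vtx m n → ℕ
  unprotNbrs s v =
    length (filter (λ w → adj? v w ×-dec T? (not (prot s w))) (vertices m n))

  mobileAt : State m n t → Vtx m n → ℕ
  mobileAt s v =
    length (filter (λ i → vtx? (pos s i) v ×-dec (moves s i <? k)) (allFin t))

  Active : State m n t → Vtx m n → Set
  Active s v = 1 ≤ unprotNbrs s v × unprotNbrs s v ≤ mobileAt s v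

  Stage : State m n t → State m n t → Set
  Stage s s' =
    (∀ i → (pos s' i ≡ pos s i × moves s' i ≡ moves s i)
         ⊎ (moves s i < k × Active s (pos s i) × Adj (pos s i) (pos s' i)
            × T (not (prot s (pos s' i))) × moves s' i ≡ suc (moves s i)))
    × (∀ v w → Active s v → Adj v w → T (not (prot s w)) →
         ∃[ i ] (pos s i ≡ v × moves s i < k × pos s' i ≡ w))
    × (∀ w → T (prot s' w) ⇔ (T (prot s w) ⊎ ∃[ i ] (pos s' i ≡ w)))

initial : ∀ {m n t} → (Fin t → Vtx m n) → State m n t
initial {t = t} L = record
  { pos   = L
  ; moves = λ _ → 0
  ; prot  = λ v → ⌊ any? (λ i → vtx? (L i) v) ⌋
  }

Successful : (k : ℕ) → ∀ {m n t} → (Fin t → Vtx m n) → Set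
Successful k {m} {n} {t} L =
  ∃[ s ] (Star (Stage k) (initial L) s × (∀ v → T (prot s v)))

DeductionNumberIs : (k m n d : ℕ) → Set
DeductionNumberIs k m n d =
  (Σ (Fin d → Vtx m n) (λ L → Successful k L))
  × (∀ t (L : Fin t → Vtx m n) → Successful k L → d ≤ t)

{-# OPTIONS --safe #-}
-- Upper bound: m searchers on the first column sweep the grid one column per stage.  Each
-- of them has exactly one unprotected neighbour, the next vertex of its row, so all of them
-- move at every stage, and crossing the n columns takes n - 1 ≤ k moves.
--
-- Lower bound: a searcher leaves a vertex only when it protects all of its unprotected
-- neighbours, so a protected vertex with an unprotected neighbour is always occupied.  Hence
-- a row containing both protected and unprotected vertices contains a searcher, and with
-- t < m ≤ n searchers some row stays entirely unprotected.  Indeed, if after a stage no row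
-- were empty, either every row is mixed (so m ≤ t), or some row R is full while before the
-- stage some row E was empty; then every column received a searcher during the stage,
-- either at its vertex in R or at the frontier between R and E on that column (so n ≤ t).
module Submission where

open import Defs
open import Data.Nat using (ℕ; suc; _≤_; zero; _<_; z≤n; s≤s; _≤?_; _<?_)
open import Data.Nat.Properties
  using (≤-trans; ≤-refl; ≤-reflexive; ≤-pred; <⇒≤; <⇒≱; ≰⇒>; n≤1+n; n<1+n; m≤n⇒m<n∨m≡n)
open import Data.Fin as Fin using (Fin; zero; suc; toℕ; fromℕ; inject₁; inject≤)
open import Data.Fin.Properties
  using ( any?; all?; ¬∀⟶∃¬; injective⇒≤; toℕ-injective; toℕ-inject₁; inject₁ℕ<; ℕ<⇒inject₁<
        ; ≤fromℕ)
open import Data.Fin.Induction using (<-weakInduction)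
open import Data.Bool using (Bool; true; false; T; not)
open import Data.Bool.Properties using (T?) renaming (_≟_ to _≟ᴮ_)
open import Data.Unit using (tt)
open import Data.Product using (∃; ∃₂; ∃-syntax; _×_; _,_; proj₁; proj₂)
import Data.Product as Product
open import Data.Sum using (_⊎_; inj₁; inj₂)
open import Data.Empty using (⊥-elim)
open import Data.List using (List; []; _∷_; length; allFin)
open import Data.List.Membership.Propositional using (_∈_)
open import Data.List.Membership.Propositional.Properties
  using (∈-filter⁺; ∈-filter⁻; ∈-allFin; ∈-cartesianProduct⁺; ∈-length)
open import Data.List.Relation.Unary.Any using (here; there)
open import Data.List.Relation.Unary.All using (_∷_)
open import Data.List.Relation.Unary.AllPairs using (_∷_)
open import Data.List.Relation.Unary.Unique.Propositional using (Unique)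
import Data.List.Relation.Unary.Unique.Propositional.Properties as Unique
open import Function using (_∘_)
open import Function.Bundles using (_⇔_; mk⇔; Equivalence)
open import Function.Definitions using (StrictlySurjective)
open import Relation.Nullary using (¬_; yes; no; contradiction)
open import Relation.Nullary.Decidable
  using (⌊_⌋; _×-dec_; toWitness; fromWitness; decidable-stable; ¬?)
open import Relation.Unary using (Decidable)
open import Relation.Binary.PropositionalEquality using (_≡_; _≢_; refl; sym; trans; cong; subst)
open import Relation.Binary.Construct.Closure.ReflexiveTransitive using (Star; ε; _◅_; _◅◅_)

T-not⇒¬T : ∀ {b} → T (not b) → ¬ T b
T-not⇒¬T {true} () _
T-not⇒¬T {false} _ ()

¬T⇒T-not : ∀ {b} → ¬ T b → T (not b)
¬T⇒T-not {true} ¬t = ¬t tt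
¬T⇒T-not {false} _ = tt

surjective⇒≤ : ∀ {a b} {f : Fin a → Fin b} → StrictlySurjective _≡_ f → b ≤ a
surjective⇒≤ {f = f} surj = injective⇒≤ {f = proj₁ ∘ surj} λ {y} {y′} eq →
  trans (sym (proj₂ (surj y))) (trans (cong f eq) (proj₂ (surj y′)))

inject₁<suc : ∀ {n} (x : Fin n) → inject₁ x Fin.< suc x
inject₁<suc x = ℕ<⇒inject₁< {i = suc x} (n<1+n (toℕ x))

≤suc⇔≤inject₁⊎≡suc : ∀ {n} {x : Fin n} {b : Fin (suc n)} →
  b Fin.≤ suc x ⇔ (b Fin.≤ inject₁ x ⊎ b ≡ suc x)
≤suc⇔≤inject₁⊎≡suc {x = x} = mk⇔ to from
  where
  to : ∀ {b} → b Fin.≤ suc x → b Fin.≤ inject₁ x ⊎ b ≡ suc x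
  to b≤ with m≤n⇒m<n∨m≡n b≤
  ... | inj₁ b< = inj₁ (≤-trans (≤-pred b<) (≤-reflexive (sym (toℕ-inject₁ x))))
  ... | inj₂ b≡ = inj₂ (toℕ-injective b≡)
  from : ∀ {b} → b Fin.≤ inject₁ x ⊎ b ≡ suc x → b Fin.≤ suc x
  from (inj₁ b≤) = ≤-trans b≤ (<⇒≤ (inject₁<suc x))
  from (inj₂ refl) = ≤-refl

nonEmpty⇒∃∈ : ∀ {A : Set} (xs : List A) → 0 < length xs → ∃ (_∈ xs)
nonEmpty⇒∃∈ (x ∷ _) _ = x , here refl

unique∧constant⇒length≤1 : ∀ {A : Set} {xs : List A} {z : A} →
  Unique xs → (∀ {y} → y ∈ xs → y ≡ z) → length xs ≤ 1
unique∧constant⇒length≤1 {xs = []} _ _ = z≤n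
unique∧constant⇒length≤1 {xs = _ ∷ []} _ _ = s≤s z≤n
unique∧constant⇒length≤1 {xs = _ ∷ _ ∷ _} ((y≢y′ ∷ _) ∷ _) const =
  ⊥-elim (y≢y′ (trans (const (here refl)) (sym (const (there (here refl))))))

changePoint : ∀ {n} (f : Fin (suc n) → Bool) {i j} → f i ≢ f j →
  ∃[ x ] f (inject₁ x) ≢ f (suc x)
changePoint {zero} f {zero} {zero} fi≢fj = ⊥-elim (fi≢fj refl)
changePoint {suc n} f {i} {j} fi≢fj with f zero ≟ᴮ f (suc zero)
... | no f₀≢f₁ = zero , f₀≢f₁
... | yes f₀≡f₁ = Product.map suc (λ fx≢fx′ → fx≢fx′)
  (changePoint (f ∘ suc) {dropZero i} {dropZero j}
    (λ eq → fi≢fj (trans (f-dropZero i) (trans eq (sym (f-dropZero j))))))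
  where
  dropZero : Fin (suc (suc n)) → Fin (suc n)
  dropZero zero = zero
  dropZero (suc x) = x

  f-dropZero : ∀ x → f x ≡ f (suc (dropZero x))
  f-dropZero zero = f₀≡f₁
  f-dropZero (suc x) = refl

boundary : ∀ {n} (f : Fin n → Bool) {a b} → T (f a) → ¬ T (f b) →
  ∃₂ λ x y → Dist1 (toℕ x) (toℕ y) × T (f x) × ¬ T (f y)
boundary {suc n} f {a} {b} fa ¬fb
  with x , fx≢fx′ ← changePoint f {a} {b} (λ eq → ¬fb (subst T eq fa))
  with f (inject₁ x) in p | f (suc x) in q
... | true  | true  = ⊥-elim (fx≢fx′ refl)
... | false | false = ⊥-elim (fx≢fx′ refl)
... | true  | false =
  inject₁ x , suc x , inj₁ (cong suc (toℕ-inject₁ x)) , subst T (sym p) tt , subst T q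
... | false | true  =
  suc x , inject₁ x , inj₂ (cong suc (toℕ-inject₁ x)) , subst T (sym q) tt , subst T p

module _ {m n t : ℕ} where

  Protected : State m n t → Vtx m n → Set
  Protected s v = T (prot s v)

  Occupied : State m n t → Vtx m n → Set
  Occupied s v = ∃[ i ] pos s i ≡ v

  protected⇔occupied-initial : (L : Fin t → Vtx m n) {v : Vtx m n} →
    Protected (initial L) v ⇔ Occupied (initial L) v
  protected⇔occupied-initial L = mk⇔ toWitness fromWitness

  1≤mobileAt⇒mobileSearcher : ∀ {k} {s : State m n t} {v} →
    1 ≤ mobileAt k s v → ∃[ i ] pos s i ≡ v × moves s i < k
  1≤mobileAt⇒mobileSearcher {k} {s} {v} 1≤mobile
    with i , i∈ ← nonEmpty⇒∃∈ _ 1≤mobile = i , proj₂ (∈-filter⁻ mobile? {xs = allFin t} i∈)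
    where
    mobile? : Decidable λ i → pos s i ≡ v × moves s i < k
    mobile? i = vtx? (pos s i) v ×-dec (moves s i <? k)

  mobile⇒1≤mobileAt : ∀ {k} {s : State m n t} {i} → moves s i < k → 1 ≤ mobileAt k s (pos s i)
  mobile⇒1≤mobileAt {k} {s} {i} mobile = ∈-length (∈-filter⁺ mobile? (∈-allFin i) (refl , mobile))
    where
    mobile? : Decidable λ j → pos s j ≡ pos s i × moves s j < k
    mobile? j = vtx? (pos s j) (pos s i) ×-dec (moves s j <? k)

  unprotectedNeighbour⇒1≤unprotNbrs : ∀ {k} {s : State m n t} {v w} →
    Adj v w → ¬ Protected s w → 1 ≤ unprotNbrs k s v
  unprotectedNeighbour⇒1≤unprotNbrs {s = s} {v} {a , b} adj ¬p =
    ∈-length (∈-filter⁺ (λ w → adj? v w ×-dec T? (not (prot s w)))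
      (∈-cartesianProduct⁺ (∈-allFin a) (∈-allFin b)) (adj , ¬T⇒T-not ¬p))

  unprotNbrs≤1 : ∀ {k} {s : State m n t} {v w₀} →
    (∀ {w} → Adj v w → ¬ Protected s w → w ≡ w₀) → unprotNbrs k s v ≤ 1
  unprotNbrs≤1 {s = s} {v} unique =
    unique∧constant⇒length≤1
      (Unique.filter⁺ unprotectedNeighbour?
        (Unique.cartesianProduct⁺ (Unique.allFin⁺ m) (Unique.allFin⁺ n)))
      λ w∈ → let _ , adj , unprotected = ∈-filter⁻ unprotectedNeighbour? {xs = vertices m n} w∈
             in unique adj (T-not⇒¬T unprotected)
    where
    unprotectedNeighbour? : Decidable λ w → Adj v w × T (not (prot s w))
    unprotectedNeighbour? w = adj? v w ×-dec T? (not (prot s w))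

module _ {k m n t : ℕ} {s s′ : State m n t} (stage : Stage k s s′) where

  protected-mono : ∀ {w} → Protected s w → Protected s′ w
  protected-mono p = Equivalence.from (proj₂ (proj₂ stage) _) (inj₁ p)

  occupied⇒protected : ∀ {w} → Occupied s′ w → Protected s′ w
  occupied⇒protected o = Equivalence.from (proj₂ (proj₂ stage) _) (inj₂ o)

  newlyProtected⇒occupied : ∀ {w} → Protected s′ w → ¬ Protected s w → Occupied s′ w
  newlyProtected⇒occupied p ¬p with Equivalence.to (proj₂ (proj₂ stage) _) p
  ... | inj₁ p₀ = contradiction p₀ ¬p
  ... | inj₂ o = o

  stays∨covers : ∀ {i v w} → pos s i ≡ v → Adj v w → ¬ Protected s w →
    pos s′ i ≡ v ⊎ Occupied s′ w
  stays∨covers {i} refl adj ¬p with proj₁ stage i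
  ... | inj₁ (stays , _) = inj₁ stays
  ... | inj₂ (_ , active , _)
    with j , _ , _ , arrives ← proj₁ (proj₂ stage) _ _ active adj (¬T⇒T-not ¬p)
    = inj₂ (j , arrives)

module _ {m n t : ℕ} where

  FrontierOccupied : State m n t → Set
  FrontierOccupied s = ∀ {v w} → Protected s v → Adj v w → ¬ Protected s w → Occupied s v

  frontierOccupied-initial : (L : Fin t → Vtx m n) → FrontierOccupied (initial L)
  frontierOccupied-initial L p _ _ = Equivalence.to (protected⇔occupied-initial L) p

  frontierOccupied-step : ∀ {k} {s s′ : State m n t} → Stage k s s′ →
    FrontierOccupied s → FrontierOccupied s′
  frontierOccupied-step {s = s} stage frontier {v} p adj ¬p′ with T? (prot s v)
  ... | no ¬p = newlyProtected⇒occupied stage p ¬p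
  ... | yes p₀
    with i , at ← frontier p₀ adj (¬p′ ∘ protected-mono stage)
    with stays∨covers stage at adj (¬p′ ∘ protected-mono stage)
  ...   | inj₁ stays = i , stays
  ...   | inj₂ o = contradiction (occupied⇒protected stage o) ¬p′

  EmptyRow FullRow : State m n t → Fin m → Set
  EmptyRow s r = ∀ j → ¬ Protected s (r , j)
  FullRow s r = ∀ j → Protected s (r , j)

  emptyRow? : ∀ s → Decidable (EmptyRow s)
  emptyRow? s r = all? λ j → ¬? (T? _)

  fullRow? : ∀ s → Decidable (FullRow s)
  fullRow? s r = all? λ j → T? _

  ¬EmptyRow⇒protected : ∀ s {r} → ¬ EmptyRow s r → ∃ λ j → Protected s (r , j)
  ¬EmptyRow⇒protected _ ¬empty =
    Product.map₂ (decidable-stable (T? _)) (¬∀⟶∃¬ _ _ (λ j → ¬? (T? _)) ¬empty)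

  ¬FullRow⇒unprotected : ∀ s {r} → ¬ FullRow s r → ∃ λ j → ¬ Protected s (r , j)
  ¬FullRow⇒unprotected _ = ¬∀⟶∃¬ _ _ λ j → T? _

  mixedRow⇒occupied : ∀ (s : State m n t) {r a b} → FrontierOccupied s →
    Protected s (r , a) → ¬ Protected s (r , b) → ∃[ i ] proj₁ (pos s i) ≡ r
  mixedRow⇒occupied s {r} frontier p ¬p
    with x , y , x~y , px , ¬py ← boundary (λ j → prot s (r , j)) p ¬p
    = Product.map₂ (cong proj₁) (frontier px (inj₂ (refl , x~y)) ¬py)

  mixedRows⇒m≤t : ∀ (s : State m n t) → FrontierOccupied s →
    (∀ r → ∃ λ a → Protected s (r , a)) → (∀ r → ∃ λ b → ¬ Protected s (r , b)) → m ≤ t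
  mixedRows⇒m≤t s frontier protected unprotected =
    surjective⇒≤ λ r → mixedRow⇒occupied s frontier (proj₂ (protected r)) (proj₂ (unprotected r))

  emptyRow⟶fullRow⇒n≤t : ∀ {k} {s s′ : State m n t} {r r′} → Stage k s s′ →
    FrontierOccupied s → EmptyRow s r → FullRow s′ r′ → n ≤ t
  emptyRow⟶fullRow⇒n≤t {s = s} {s′} {r} {r′} stage frontier empty full =
    surjective⇒≤ columnOccupied
    where
    columnOccupied : ∀ j → ∃[ i ] proj₂ (pos s′ i) ≡ j
    columnOccupied j with T? (prot s (r′ , j))
    ... | no ¬p = Product.map₂ (cong proj₂) (newlyProtected⇒occupied stage (full j) ¬p)
    ... | yes p
      with x , y , x~y , px , ¬py ← boundary (λ x → prot s (x , j)) p (empty j)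
      with i , at ← frontier px (inj₁ (x~y , refl)) ¬py
      with stays∨covers stage at (inj₁ (x~y , refl)) ¬py
    ...   | inj₁ stays = i , cong proj₂ stays
    ...   | inj₂ (i′ , arrives) = i′ , cong proj₂ arrives

  Blocked : State m n t → Set
  Blocked s = FrontierOccupied s × ∃ (EmptyRow s)

  module _ (t<m : t < m) (m≤n : m ≤ n) where

    emptyRow-initial : (L : Fin t → Vtx m n) → ∃ (EmptyRow (initial L))
    emptyRow-initial L with any? (emptyRow? (initial L))
    ... | yes emptyRow = emptyRow
    ... | no noEmptyRow = contradiction (surjective⇒≤ rowOccupied) (<⇒≱ t<m)
      where
      rowOccupied : ∀ r → ∃[ i ] proj₁ (L i) ≡ r
      rowOccupied r
        with _ , p ← ¬EmptyRow⇒protected (initial L) (noEmptyRow ∘ (r ,_))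
        with i , at ← Equivalence.to (protected⇔occupied-initial L) p = i , cong proj₁ at

    emptyRow-step : ∀ {k} {s s′ : State m n t} → Stage k s s′ → FrontierOccupied s →
      ∃ (EmptyRow s) → ∃ (EmptyRow s′)
    emptyRow-step {s′ = s′} stage frontier (r , empty)
      with any? (fullRow? s′) | any? (emptyRow? s′)
    ... | yes (r′ , full) | _ =
      contradiction (emptyRow⟶fullRow⇒n≤t stage frontier empty full) (<⇒≱ (≤-trans t<m m≤n))
    ... | no _ | yes emptyRow = emptyRow
    ... | no noFullRow | no noEmptyRow = contradiction
      (mixedRows⇒m≤t s′ (frontierOccupied-step stage frontier)
        (λ r → ¬EmptyRow⇒protected s′ (noEmptyRow ∘ (r ,_)))
        (λ r → ¬FullRow⇒unprotected s′ (noFullRow ∘ (r ,_))))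
      (<⇒≱ t<m)

    blocked-initial : (L : Fin t → Vtx m n) → Blocked (initial L)
    blocked-initial L = frontierOccupied-initial L , emptyRow-initial L

    blocked-star : ∀ {k} {s s′ : State m n t} → Star (Stage k) s s′ → Blocked s → Blocked s′
    blocked-star ε blocked = blocked
    blocked-star (stage ◅ stages) (frontier , emptyRow) =
      blocked-star stages
        (frontierOccupied-step stage frontier , emptyRow-step stage frontier emptyRow)

successful⇒m≤t : ∀ {k m n t} → m ≤ n → (L : Fin t → Vtx m n) → Successful k L → m ≤ t
successful⇒m≤t {m = m} {t = t} m≤n L (_ , stages , allProtected) =
  decidable-stable (m ≤? t) λ m≰t →
    let _ , r , empty = blocked-star (≰⇒> m≰t) m≤n stages (blocked-initial (≰⇒> m≰t) m≤n L)
        j = inject≤ r m≤n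
    in empty j (allProtected (r , j))

firstColumn : ∀ {m n} → Fin m → Vtx m (suc n)
firstColumn i = i , zero

module _ {m n : ℕ} where

  -- Protection is a parameter so that initial firstColumn is definitionally a column state.
  column : Fin n → (Vtx m n → Bool) → State m n m
  column c p = record { pos = λ i → i , c ; moves = λ _ → toℕ c ; prot = p }

  ProtectsUpTo : Fin n → (Vtx m n → Bool) → Set
  ProtectsUpTo c p = ∀ v → T (p v) ⇔ proj₂ v Fin.≤ c

  upTo : Fin n → Vtx m n → Bool
  upTo c (_ , b) = ⌊ b Fin.≤? c ⌋

  protectsUpTo-upTo : ∀ c → ProtectsUpTo c (upTo c)
  protectsUpTo-upTo c _ = mk⇔ toWitness fromWitness

protectsUpTo-initial : ∀ {m n} → ProtectsUpTo zero (prot (initial (firstColumn {m} {n})))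
protectsUpTo-initial _ = mk⇔ to from
  where
  to : ∀ {m n} {a : Fin m} {b : Fin (suc n)} →
    T (prot (initial firstColumn) (a , b)) → b Fin.≤ zero {n}
  to p with _ , refl ← Equivalence.to (protected⇔occupied-initial firstColumn) p = z≤n
  from : ∀ {m n} {a : Fin m} {b : Fin (suc n)} →
    b Fin.≤ zero {n} → T (prot (initial firstColumn) (a , b))
  from {a = a} {zero} _ = Equivalence.from (protected⇔occupied-initial firstColumn) (a , refl)

module _ {k m n : ℕ} (x : Fin n) (x<k : toℕ (inject₁ x) < k)
         {p : Vtx m (suc n) → Bool} (upTo-x : ProtectsUpTo (inject₁ x) p) where

  private
    s s′ : State m (suc n) m
    s = column (inject₁ x) p
    s′ = column (suc x) (upTo (suc x))

    inject₁≡ : suc (toℕ (inject₁ x)) ≡ toℕ (suc x)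
    inject₁≡ = cong suc (toℕ-inject₁ x)

  nextColumn-unprotected : ∀ {i} → ¬ T (p (i , suc x))
  nextColumn-unprotected q = <⇒≱ (inject₁<suc x) (Equivalence.to (upTo-x _) q)

  nextColumn-adjacent : ∀ (i : Fin m) → Adj (i , inject₁ x) (i , suc x)
  nextColumn-adjacent i = inj₂ (refl , inj₁ inject₁≡)

  unprotectedNeighbour≡nextColumn : ∀ {i w} → Adj (i , inject₁ x) w → ¬ T (p w) → w ≡ (i , suc x)
  unprotectedNeighbour≡nextColumn (inj₁ (_ , refl)) ¬p =
    contradiction (Equivalence.from (upTo-x _) ≤-refl) ¬p
  unprotectedNeighbour≡nextColumn (inj₂ (refl , inj₁ e)) _ =
    cong (_ ,_) (toℕ-injective (trans (sym e) inject₁≡))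
  unprotectedNeighbour≡nextColumn (inj₂ (refl , inj₂ e)) ¬p =
    contradiction (Equivalence.from (upTo-x _) (≤-trans (n≤1+n _) (≤-reflexive e))) ¬p

  column-active : ∀ (i : Fin m) → Active k s (i , inject₁ x)
  column-active i =
    unprotectedNeighbour⇒1≤unprotNbrs {k = k} {s = s}
      (nextColumn-adjacent i) nextColumn-unprotected ,
    ≤-trans (unprotNbrs≤1 {k = k} {s = s} unprotectedNeighbour≡nextColumn)
            (mobile⇒1≤mobileAt {s = s} x<k)

  searcher-advances : ∀ i →
    toℕ (inject₁ x) < k × Active k s (i , inject₁ x) × Adj (i , inject₁ x) (i , suc x) ×
    T (not (p (i , suc x))) × toℕ (suc x) ≡ suc (toℕ (inject₁ x))
  searcher-advances i =
    x<k , column-active i , nextColumn-adjacent i , ¬T⇒T-not nextColumn-unprotected , sym inject₁≡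

  unprotectedNeighbour-covered : ∀ v w → Active k s v → Adj v w → T (not (p w)) →
    ∃[ i ] ((i , inject₁ x) ≡ v × toℕ (inject₁ x) < k × (i , suc x) ≡ w)
  unprotectedNeighbour-covered v w active adj unprotected
    with i , refl , mobile ← 1≤mobileAt⇒mobileSearcher {s = s} {v}
                               (≤-trans (proj₁ active) (proj₂ active))
    = i , refl , mobile , sym (unprotectedNeighbour≡nextColumn adj (T-not⇒¬T unprotected))

  upTo-suc⇔protected⊎nextColumn : ∀ w → T (upTo (suc x) w) ⇔ (T (p w) ⊎ ∃[ i ] (i , suc x) ≡ w)
  upTo-suc⇔protected⊎nextColumn (a , b) = mk⇔ to from
    where
    ≤suc⇔ : b Fin.≤ suc x ⇔ (b Fin.≤ inject₁ x ⊎ b ≡ suc x)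
    ≤suc⇔ = ≤suc⇔≤inject₁⊎≡suc

    to : T (upTo (suc x) (a , b)) → T (p (a , b)) ⊎ ∃[ i ] (i , suc x) ≡ (a , b)
    to b≤ with Equivalence.to ≤suc⇔ (toWitness b≤)
    ... | inj₁ b≤x = inj₁ (Equivalence.from (upTo-x _) b≤x)
    ... | inj₂ refl = inj₂ (a , refl)

    from : T (p (a , b)) ⊎ ∃[ i ] (i , suc x) ≡ (a , b) → T (upTo (suc x) (a , b))
    from (inj₁ q) = fromWitness (Equivalence.from ≤suc⇔ (inj₁ (Equivalence.to (upTo-x _) q)))
    from (inj₂ (_ , refl)) = fromWitness (Equivalence.from ≤suc⇔ (inj₂ refl))

  sweepStage : Stage k s s′
  sweepStage =
    inj₂ ∘ searcher-advances , unprotectedNeighbour-covered , upTo-suc⇔protected⊎nextColumn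

ColumnReachable : (k m : ℕ) {n : ℕ} → Fin (suc n) → Set
ColumnReachable k m c =
  ∃ λ p → Star (Stage k) (initial (firstColumn {m})) (column c p) × ProtectsUpTo c p

columnReachable : ∀ {k m n} → n ≤ k → (c : Fin (suc n)) → ColumnReachable k m c
columnReachable {k} {m} n≤k = <-weakInduction (ColumnReachable k m) (_ , ε , protectsUpTo-initial)
  λ x (p , stages , upTo-x) →
    upTo (suc x) , stages ◅◅ sweepStage x (≤-trans (inject₁ℕ< x) n≤k) upTo-x ◅ ε ,
    protectsUpTo-upTo (suc x)

firstColumn-successful : ∀ {k m n} → n ≤ k → Successful k (firstColumn {m} {n})
firstColumn-successful {n = n} n≤k
  with p , stages , upTo-last ← columnReachable n≤k (fromℕ n)
  = column (fromℕ n) p , stages , λ v → Equivalence.from (upTo-last v) (≤fromℕ (proj₂ v))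

corollary4p3 : (k m n : ℕ) → 1 ≤ k → 2 ≤ m → m ≤ n → n ≤ suc k →
    DeductionNumberIs k m n m
corollary4p3 k m zero _ 2≤m m≤n _ = contradiction (≤-trans 2≤m m≤n) λ ()
corollary4p3 k m (suc n) _ _ m≤n n≤k =
  (firstColumn , firstColumn-successful (≤-pred n≤k)) , λ t L → successful⇒m≤t m≤n L
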